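{- For functions $g,h:\omega\to\omega$, if $h\le_{\mathrm{scf}} g$ then $h\le_{\mathrm{ubfb}} g$.
   Context: A strong cofinite description of $g$ is a total function $f:\omega\to\omega\cup\{\square\}$ ($\square$ a symbol not in $\omega$) such that $f(n)=g(n)$ whenever $f(n)\ne\square$, and $f(n)\ne\square$ for all but finitely many $n$. $h\le_{\mathrm{scf}} g$ means there is a Turing functional $\Phi$ such that $\Phi^f$ is a strong cofinite description of $h$ for every strong cofinite description $f$ of $g$. $h\le_{\mathrm{ubfb}} g$ means $h=\Phi^g$ for some Turing functional $\Phi$ such that the least argument at which $g$ is queried during the computation of $\Phi^g(n)$ tends to infinity with $n$. -}

module Defs where

open import Data.Nat using (ℕ; zero; suc; _≤_)
open import Data.Fin using (Fin)
open import Data.Vec using (Vec; []; _∷_; lookup)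
open import Data.List using (List; []; _∷_; _++_)
open import Data.List.Relation.Unary.All using (All)
open import Data.Maybe using (Maybe; just; nothing)
open import Data.Product using (Σ; ∃; ∃-syntax; _×_)
open import Relation.Binary.PropositionalEquality using (_≡_)

-- Turing functionals, modelled as (Kleene) partial recursive functions
-- relative to an oracle α : ℕ → ℕ.  A code of arity k denotes a partial
-- function ℕ^k ⇀ ℕ with oracle access.

data Code : ℕ → Set where
  zer  : ∀ {k} → Code k
  succ : Code 1
  proj : ∀ {k} → Fin k → Code k
  orc  : Code 1
  comp : ∀ {k m} → Code m → Vec (Code k) m → Code k
  prec : ∀ {k} → Code k → Code (suc (suc k)) → Code (suc k)
  mu   : ∀ {k} → Code (suc k) → Code k

-- Eval α e xs v qs : on input xs, with oracle α,
-- the computation of e halts with output v, and qs is the list of all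
-- arguments at which the oracle was queried during the computation.
data Eval (α : ℕ → ℕ) : ∀ {k} → Code k → Vec ℕ k → ℕ → List ℕ → Set
data EvalVec (α : ℕ → ℕ) : ∀ {k m} → Vec (Code k) m → Vec ℕ k → Vec ℕ m → List ℕ → Set
data Search (α : ℕ → ℕ) {k : ℕ} (F : Code (suc k)) (xs : Vec ℕ k) : ℕ → ℕ → List ℕ → Set

data Eval α where
  e-zer  : ∀ {k} {xs : Vec ℕ k} → Eval α zer xs 0 []
  e-succ : ∀ {x} → Eval α succ (x ∷ []) (suc x) []
  e-proj : ∀ {k} {i : Fin k} {xs} → Eval α (proj i) xs (lookup xs i) []
  e-orc  : ∀ {x} → Eval α orc (x ∷ []) (α x) (x ∷ [])
  e-comp : ∀ {k m} {f : Code m} {gs : Vec (Code k) m} {xs ys v qs qs'} →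
           EvalVec α gs xs ys qs → Eval α f ys v qs' →
           Eval α (comp f gs) xs v (qs ++ qs')
  e-prec0 : ∀ {k} {b : Code k} {s xs v qs} →
            Eval α b xs v qs → Eval α (prec b s) (0 ∷ xs) v qs
  e-precS : ∀ {k} {b : Code k} {s xs n r v qs qs'} →
            Eval α (prec b s) (n ∷ xs) r qs →
            Eval α s (n ∷ r ∷ xs) v qs' →
            Eval α (prec b s) (suc n ∷ xs) v (qs ++ qs')
  e-mu   : ∀ {k} {F : Code (suc k)} {xs v qs} →
           Search α F xs 0 v qs → Eval α (mu F) xs v qs

data EvalVec α where
  ev-[] : ∀ {k} {xs : Vec ℕ k} → EvalVec α [] xs [] []
  ev-∷  : ∀ {k m} {g : Code k} {gs : Vec (Code k) m} {xs y ys qs qs'} →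
          Eval α g xs y qs → EvalVec α gs xs ys qs' →
          EvalVec α (g ∷ gs) xs (y ∷ ys) (qs ++ qs')

data Search α F xs where
  s-hit  : ∀ {y qs} → Eval α F (y ∷ xs) 0 qs → Search α F xs y y qs
  s-next : ∀ {y z v qs qs'} →
           Eval α F (y ∷ xs) (suc z) qs → Search α F xs (suc y) v qs' →
           Search α F xs y v (qs ++ qs')

TuringFunctional : Set
TuringFunctional = Code 1

_⟨_⟩_↓_ : TuringFunctional → (ℕ → ℕ) → ℕ → ℕ → Set
Φ ⟨ α ⟩ n ↓ v = ∃[ qs ] Eval α Φ (n ∷ []) v qs

-- ω ∪ {□} is Maybe ℕ, with □ = nothing.  For oracle access and output,
-- ω ∪ {□} is coded into ℕ by □ ↦ 0, m ↦ m + 1.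

□ : Maybe ℕ
□ = nothing

code : Maybe ℕ → ℕ
code nothing  = 0
code (just m) = suc m

IsSCF : (ℕ → Maybe ℕ) → (ℕ → ℕ) → Set
IsSCF f g = (∀ n y → f n ≡ just y → y ≡ g n)
          × (∃[ N ] ∀ n → N ≤ n → ∃[ y ] f n ≡ just y)

_computesᴹ_from_ : TuringFunctional → (ℕ → Maybe ℕ) → (ℕ → Maybe ℕ) → Set
Φ computesᴹ F from f = ∀ n → Φ ⟨ code-fn f ⟩ n ↓ code (F n)
  where
  code-fn : (ℕ → Maybe ℕ) → ℕ → ℕ
  code-fn f x = code (f x)

_≤scf_ : (ℕ → ℕ) → (ℕ → ℕ) → Set
h ≤scf g = ∃[ Φ ] ∀ (f : ℕ → Maybe ℕ) → IsSCF f g →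
             ∃[ F ] (Φ computesᴹ F from f × IsSCF F h)

_≤ubfb_ : (ℕ → ℕ) → (ℕ → ℕ) → Set
h ≤ubfb g = ∃[ Φ ] ((∀ n → Φ ⟨ g ⟩ n ↓ h n)
                   × (∀ m → ∃[ N ] ∀ n → N ≤ n →
                        ∀ v qs → Eval g Φ (n ∷ []) v qs → All (m ≤_) qs))

module Submission where

-- The function maskBelow g k, which hides g below k, is a strong cofinite
-- description of g, so Φ turns it into a description F k of h; and Φ run on
-- this mask can be simulated from g itself without ever querying g below k.
-- To compute h n, try the masks k = n, n - 1, …, 0 and output the first
-- defined value F k n.  Once n is large enough that F m n is defined, the
-- search stops at a mask ≥ m, so every query made is ≥ m.

open import Defs
open import Data.Nat using (ℕ; zero; suc; pred; _+_; _∸_; _⊔_; _≤_; _<_; z≤n; s≤s; _≤?_)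
open import Data.Nat.Properties
open import Data.Fin as Fin using (Fin; zero; suc)
open import Data.Vec using (Vec; []; _∷_; lookup; tabulate; _∷ʳ_)
open import Data.Vec.Properties using (tabulate∘lookup)
open import Data.List using (List; []; _∷_)
open import Data.List.Relation.Unary.All as All using (All; []; _∷_)
open import Data.List.Relation.Unary.All.Properties using (++⁺)
open import Data.Maybe using (Maybe; just; nothing)
open import Data.Product using (∃-syntax; _×_; _,_; proj₁; proj₂)
open import Function using (_∘_)
open import Relation.Nullary using (yes; no; contradiction)
open import Relation.Binary.PropositionalEquality

private
  variable
    α : ℕ → ℕ
    j k m n v v′ : ℕ
    xs : Vec ℕ k
    qs qs′ : List ℕ

Eval-deterministic : ∀ {e : Code k} →
  Eval α e xs v qs → Eval α e xs v′ qs′ → v ≡ v′ × qs ≡ qs′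
EvalVec-deterministic : ∀ {m} {gs : Vec (Code k) m} {xs ys ys′ qs qs′} →
  EvalVec α gs xs ys qs → EvalVec α gs xs ys′ qs′ → ys ≡ ys′ × qs ≡ qs′
Search-deterministic : ∀ {F : Code (suc k)} {xs y z z′ qs qs′} →
  Search α F xs y z qs → Search α F xs y z′ qs′ → z ≡ z′ × qs ≡ qs′

Eval-deterministic e-zer e-zer = refl , refl
Eval-deterministic e-succ e-succ = refl , refl
Eval-deterministic e-proj e-proj = refl , refl
Eval-deterministic e-orc e-orc = refl , refl
Eval-deterministic (e-comp a b) (e-comp a′ b′) with EvalVec-deterministic a a′
... | refl , refl with Eval-deterministic b b′
... | refl , refl = refl , refl
Eval-deterministic (e-prec0 a) (e-prec0 a′) = Eval-deterministic a a′
Eval-deterministic (e-precS a b) (e-precS a′ b′) with Eval-deterministic a a′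
... | refl , refl with Eval-deterministic b b′
... | refl , refl = refl , refl
Eval-deterministic (e-mu s) (e-mu s′) = Search-deterministic s s′

EvalVec-deterministic ev-[] ev-[] = refl , refl
EvalVec-deterministic (ev-∷ a b) (ev-∷ a′ b′)
  with Eval-deterministic a a′ | EvalVec-deterministic b b′
... | refl , refl | refl , refl = refl , refl

Search-deterministic (s-hit a) (s-hit a′) = refl , proj₂ (Eval-deterministic a a′)
Search-deterministic (s-hit a) (s-next a′ _) with Eval-deterministic a a′
... | () , _
Search-deterministic (s-next a _) (s-hit a′) with Eval-deterministic a a′
... | () , _
Search-deterministic (s-next a b) (s-next a′ b′) with Eval-deterministic a a′
... | refl , refl with Search-deterministic b b′
... | refl , refl = refl , refl

Eval≥ : (ℕ → ℕ) → ℕ → Code k → Vec ℕ k → ℕ → Set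
Eval≥ α m e xs v = ∃[ qs ] Eval α e xs v qs × All (m ≤_) qs

EvalVec≥ : ∀ {l} → (ℕ → ℕ) → ℕ → Vec (Code k) l → Vec ℕ k → Vec ℕ l → Set
EvalVec≥ α m gs xs ys = ∃[ qs ] EvalVec α gs xs ys qs × All (m ≤_) qs

Search≥ : (ℕ → ℕ) → ℕ → Code (suc k) → Vec ℕ k → ℕ → ℕ → Set
Search≥ α m F xs y z = ∃[ qs ] Search α F xs y z qs × All (m ≤_) qs

queryFree : ∀ {e : Code k} → Eval α e xs v [] → Eval≥ α m e xs v
queryFree E = [] , E , []

queryFreeVec : ∀ {l} {gs : Vec (Code k) l} {ys} → EvalVec α gs xs ys [] → EvalVec≥ α m gs xs ys
queryFreeVec E = [] , E , []

comp≥ : ∀ {l} {f : Code l} {gs : Vec (Code k) l} {ys} →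
  EvalVec≥ α m gs xs ys → Eval≥ α m f ys v → Eval≥ α m (comp f gs) xs v
comp≥ (_ , a , p) (_ , b , q) = _ , e-comp a b , ++⁺ p q

prec0≥ : ∀ {b : Code k} {s} → Eval≥ α m b xs v → Eval≥ α m (prec b s) (0 ∷ xs) v
prec0≥ (_ , a , p) = _ , e-prec0 a , p

precS≥ : ∀ {b : Code k} {s r} →
  Eval≥ α m (prec b s) (n ∷ xs) r → Eval≥ α m s (n ∷ r ∷ xs) v →
  Eval≥ α m (prec b s) (suc n ∷ xs) v
precS≥ (_ , a , p) (_ , b , q) = _ , e-precS a b , ++⁺ p q

mu≥ : ∀ {F : Code (suc k)} → Search≥ α m F xs 0 v → Eval≥ α m (mu F) xs v
mu≥ (_ , s , p) = _ , e-mu s , p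

[]≥ : EvalVec≥ α m [] xs []
[]≥ = [] , ev-[] , []

∷≥ : ∀ {l} {g : Code k} {gs : Vec (Code k) l} {y ys} →
  Eval≥ α m g xs y → EvalVec≥ α m gs xs ys → EvalVec≥ α m (g ∷ gs) xs (y ∷ ys)
∷≥ (_ , a , p) (_ , b , q) = _ , ev-∷ a b , ++⁺ p q

hit≥ : ∀ {F : Code (suc k)} {y} → Eval≥ α m F (y ∷ xs) 0 → Search≥ α m F xs y y
hit≥ (_ , a , p) = _ , s-hit a , p

next≥ : ∀ {F : Code (suc k)} {y z} →
  Eval≥ α m F (y ∷ xs) (suc v) → Search≥ α m F xs (suc y) z → Search≥ α m F xs y z
next≥ (_ , a , p) (_ , b , q) = _ , s-next a b , ++⁺ p q

weaken≥ : ∀ {e : Code k} {m′} → m′ ≤ m → Eval≥ α m e xs v → Eval≥ α m′ e xs v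
weaken≥ m′≤m (_ , E , p) = _ , E , All.map (≤-trans m′≤m) p

Eval≥-queries : ∀ {e : Code k} → Eval≥ α m e xs v → Eval α e xs v′ qs → All (m ≤_) qs
Eval≥-queries (_ , E , p) E′ with Eval-deterministic E E′
... | refl , refl = p

constᶜ : ℕ → Code k
constᶜ zero = zer
constᶜ (suc a) = comp succ (constᶜ a ∷ [])

constᶜ-eval : ∀ a → Eval α (constᶜ a) xs a []
constᶜ-eval zero = e-zer
constᶜ-eval (suc a) = e-comp (ev-∷ (constᶜ-eval a) ev-[]) e-succ

predᶜ : Code 1
predᶜ = prec zer (proj zero)

predᶜ-eval : ∀ n → Eval α predᶜ (n ∷ []) (pred n) []
predᶜ-eval zero = e-prec0 e-zer
predᶜ-eval (suc n) = e-precS (predᶜ-eval n) e-proj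

flip∸ᶜ : Code 2
flip∸ᶜ = prec (proj zero) (comp predᶜ (proj (suc zero) ∷ []))

flip∸ᶜ-eval : ∀ a b → Eval α flip∸ᶜ (a ∷ b ∷ []) (b ∸ a) []
flip∸ᶜ-eval zero b = e-prec0 e-proj
flip∸ᶜ-eval {α} (suc a) b =
  subst (λ v → Eval α flip∸ᶜ (suc a ∷ b ∷ []) v []) (pred[m∸n]≡m∸[1+n] b a)
    (e-precS (flip∸ᶜ-eval a b) (e-comp (ev-∷ e-proj ev-[]) (predᶜ-eval (b ∸ a))))

isZeroᶜ : Code 1
isZeroᶜ = comp flip∸ᶜ (proj zero ∷ constᶜ 1 ∷ [])

isZeroᶜ-eval : ∀ n → Eval α isZeroᶜ (n ∷ []) (1 ∸ n) []
isZeroᶜ-eval n = e-comp (ev-∷ e-proj (ev-∷ (constᶜ-eval 1) ev-[])) (flip∸ᶜ-eval n 1)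

1∸n≡0 : 0 < n → 1 ∸ n ≡ 0
1∸n≡0 {suc n} _ = 0∸n≡0 n

≥ᶜ : Code 2
≥ᶜ = comp isZeroᶜ (comp flip∸ᶜ (proj zero ∷ proj (suc zero) ∷ []) ∷ [])

≥ᶜ-eval : ∀ x y → Eval α ≥ᶜ (x ∷ y ∷ []) (1 ∸ (y ∸ x)) []
≥ᶜ-eval x y =
  e-comp (ev-∷ (e-comp (ev-∷ e-proj (ev-∷ e-proj ev-[])) (flip∸ᶜ-eval x y)) ev-[])
         (isZeroᶜ-eval (y ∸ x))

≥ᶜ-yes : ∀ {x y} → y ≤ x → Eval α ≥ᶜ (x ∷ y ∷ []) 1 []
≥ᶜ-yes {α} {x} {y} y≤x =
  subst (λ v → Eval α ≥ᶜ (x ∷ y ∷ []) v []) (cong (1 ∸_) (m≤n⇒m∸n≡0 y≤x)) (≥ᶜ-eval x y)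

≥ᶜ-no : ∀ {x y} → x < y → Eval α ≥ᶜ (x ∷ y ∷ []) 0 []
≥ᶜ-no {α} {x} {y} x<y =
  subst (λ v → Eval α ≥ᶜ (x ∷ y ∷ []) v []) (1∸n≡0 (m<n⇒0<n∸m x<y)) (≥ᶜ-eval x y)

atLeastᶜ : ℕ → Code 1
atLeastᶜ N = comp ≥ᶜ (proj zero ∷ constᶜ N ∷ [])

atLeastᶜ-yes : ∀ {N} → N ≤ n → Eval α (atLeastᶜ N) (n ∷ []) 1 []
atLeastᶜ-yes {N = N} N≤n = e-comp (ev-∷ e-proj (ev-∷ (constᶜ-eval N) ev-[])) (≥ᶜ-yes N≤n)

atLeastᶜ-no : ∀ {N} → n < N → Eval α (atLeastᶜ N) (n ∷ []) 0 []
atLeastᶜ-no {N = N} n<N = e-comp (ev-∷ e-proj (ev-∷ (constᶜ-eval N) ev-[])) (≥ᶜ-no n<N)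

projectionsᶜ-eval : (σ : Fin j → Fin k) (ys : Vec ℕ k) →
  EvalVec α (tabulate (proj ∘ σ)) ys (tabulate (lookup ys ∘ σ)) []
projectionsᶜ-eval {zero} σ ys = ev-[]
projectionsᶜ-eval {suc j} σ ys = ev-∷ e-proj (projectionsᶜ-eval (σ ∘ Fin.suc) ys)

identityᶜ-eval : (xs : Vec ℕ k) → EvalVec α (tabulate proj) xs xs []
identityᶜ-eval {α = α} xs =
  subst (λ ys → EvalVec α (tabulate proj) xs ys []) (tabulate∘lookup xs)
    (projectionsᶜ-eval (λ i → i) xs)

dropTwoᶜ-eval : ∀ x y (xs : Vec ℕ k) →
  EvalVec α (tabulate (proj ∘ Fin.suc ∘ Fin.suc)) (x ∷ y ∷ xs) xs []
dropTwoᶜ-eval {α = α} x y xs =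
  subst (λ ys → EvalVec α (tabulate (proj ∘ Fin.suc ∘ Fin.suc)) (x ∷ y ∷ xs) ys []) (tabulate∘lookup xs)
    (projectionsᶜ-eval (Fin.suc ∘ Fin.suc) (x ∷ y ∷ xs))

ifᶜ_then_else_ : Code k → Code k → Code k → Code k
ifᶜ t then a else b = comp (prec b (comp a (tabulate (proj ∘ Fin.suc ∘ Fin.suc)))) (t ∷ tabulate proj)

-- Recursion reaches the step at 1 only through the base case, so the else
-- branch must halt even when the test succeeds.
ifᶜ-then : ∀ {t a b : Code k} {v₀} →
  Eval≥ α m t xs 1 → Eval≥ α m a xs v → Eval≥ α m b xs v₀ →
  Eval≥ α m (ifᶜ t then a else b) xs v
ifᶜ-then {xs = xs} t↓1 a↓ b↓ =
  comp≥ (∷≥ t↓1 (queryFreeVec (identityᶜ-eval xs)))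
        (precS≥ (prec0≥ b↓) (comp≥ (queryFreeVec (dropTwoᶜ-eval 0 _ xs)) a↓))

ifᶜ-else : ∀ {t a b : Code k} →
  Eval≥ α m t xs 0 → Eval≥ α m b xs v → Eval≥ α m (ifᶜ t then a else b) xs v
ifᶜ-else {xs = xs} t↓0 b↓ = comp≥ (∷≥ t↓0 (queryFreeVec (identityᶜ-eval xs))) (prec0≥ b↓)

tableᶜ : (ℕ → ℕ) → ℕ → Code 1
tableᶜ t zero = zer
tableᶜ t (suc N) = prec (constᶜ (t 0)) (comp (tableᶜ (t ∘ suc) N) (proj zero ∷ []))

tableᶜ-eval : ∀ t N n → n < N → Eval α (tableᶜ t N) (n ∷ []) (t n) []
tableᶜ-eval t (suc N) zero _ = e-prec0 (constᶜ-eval (t 0))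
tableᶜ-eval t (suc N) (suc n) (s≤s n<N) =
  e-precS (tableᶜ-eval t (suc N) n (m<n⇒m<1+n n<N))
          (e-comp (ev-∷ e-proj ev-[]) (tableᶜ-eval (t ∘ suc) N n n<N))

tableᶜ-halts : ∀ t N n → ∃[ v ] Eval α (tableᶜ t N) (n ∷ []) v []
tableᶜ-halts t zero n = 0 , e-zer
tableᶜ-halts t (suc N) zero = t 0 , e-prec0 (constᶜ-eval (t 0))
tableᶜ-halts t (suc N) (suc n) with tableᶜ-halts t (suc N) n | tableᶜ-halts (t ∘ suc) N n
... | _ , E | v , E′ = v , e-precS E (e-comp (ev-∷ e-proj ev-[]) E′)

maskBelow : (ℕ → ℕ) → ℕ → ℕ → Maybe ℕ
maskBelow g k x with k ≤? x
... | yes _ = just (g x)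
... | no  _ = □

maskBelow-isSCF : ∀ g k → IsSCF (maskBelow g k) g
maskBelow-isSCF g k = agrees , k , defined
  where
  agrees : ∀ n y → maskBelow g k n ≡ just y → y ≡ g n
  agrees n y eq with k ≤? n
  agrees n y refl | yes _ = refl
  agrees n y ()   | no  _

  defined : ∀ n → k ≤ n → ∃[ y ] maskBelow g k n ≡ just y
  defined n k≤n with k ≤? n
  ... | yes _   = g n , refl
  ... | no  k≰n = contradiction k≤n k≰n

maskedOracleᶜ : Code 2
maskedOracleᶜ = ifᶜ ≥ᶜ then comp succ (comp orc (proj zero ∷ []) ∷ []) else zer

maskedOracleᶜ-eval : ∀ g k x → Eval≥ g k maskedOracleᶜ (x ∷ k ∷ []) (code (maskBelow g k x))
maskedOracleᶜ-eval g k x with k ≤? x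
... | yes k≤x = ifᶜ-then (queryFree (≥ᶜ-yes k≤x))
                         (_ , e-comp (ev-∷ (e-comp (ev-∷ e-proj ev-[]) e-orc) ev-[]) e-succ , k≤x ∷ [])
                         (queryFree e-zer)
... | no  k≰x = ifᶜ-else (queryFree (≥ᶜ-no (≰⇒> k≰x))) (queryFree e-zer)

maskedᶜ : Code k → Code (suc k)
maskedᶜs : ∀ {l} → Vec (Code k) l → Vec (Code (suc k)) (suc l)
maskedᶜ zer = zer
maskedᶜ succ = comp succ (proj zero ∷ [])
maskedᶜ (proj i) = proj (Fin.inject₁ i)
maskedᶜ orc = maskedOracleᶜ
maskedᶜ (comp f gs) = comp (maskedᶜ f) (maskedᶜs gs)
maskedᶜ (prec b s) = prec (maskedᶜ b) (maskedᶜ s)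
maskedᶜ (mu F) = mu (maskedᶜ F)
maskedᶜs {k} [] = proj (Fin.fromℕ k) ∷ []
maskedᶜs (g ∷ gs) = maskedᶜ g ∷ maskedᶜs gs

lookup-∷ʳ-inject₁ : (xs : Vec ℕ k) (i : Fin k) → lookup (xs ∷ʳ n) (Fin.inject₁ i) ≡ lookup xs i
lookup-∷ʳ-inject₁ (x ∷ xs) zero = refl
lookup-∷ʳ-inject₁ (x ∷ xs) (suc i) = lookup-∷ʳ-inject₁ xs i

lookup-∷ʳ-fromℕ : (xs : Vec ℕ k) → lookup (xs ∷ʳ n) (Fin.fromℕ k) ≡ n
lookup-∷ʳ-fromℕ [] = refl
lookup-∷ʳ-fromℕ (x ∷ xs) = lookup-∷ʳ-fromℕ xs

module _ (g : ℕ → ℕ) (k : ℕ) where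

  maskedᶜ-sound : ∀ {e : Code j} {xs} →
    Eval (code ∘ maskBelow g k) e xs v qs → Eval≥ g k (maskedᶜ e) (xs ∷ʳ k) v
  maskedᶜs-sound : ∀ {l} {gs : Vec (Code j) l} {xs ys} →
    EvalVec (code ∘ maskBelow g k) gs xs ys qs → EvalVec≥ g k (maskedᶜs gs) (xs ∷ʳ k) (ys ∷ʳ k)
  maskedᶜ-search : ∀ {F : Code (suc j)} {xs y z} →
    Search (code ∘ maskBelow g k) F xs y z qs → Search≥ g k (maskedᶜ F) (xs ∷ʳ k) y z

  maskedᶜ-sound e-zer = queryFree e-zer
  maskedᶜ-sound e-succ = queryFree (e-comp (ev-∷ e-proj ev-[]) e-succ)
  maskedᶜ-sound {xs = xs} (e-proj {i = i}) =
    queryFree (subst (λ v → Eval g (proj (Fin.inject₁ i)) (xs ∷ʳ k) v []) (lookup-∷ʳ-inject₁ xs i) e-proj)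
  maskedᶜ-sound (e-orc {x}) = maskedOracleᶜ-eval g k x
  maskedᶜ-sound (e-comp a b) = comp≥ (maskedᶜs-sound a) (maskedᶜ-sound b)
  maskedᶜ-sound (e-prec0 a) = prec0≥ (maskedᶜ-sound a)
  maskedᶜ-sound (e-precS a b) = precS≥ (maskedᶜ-sound a) (maskedᶜ-sound b)
  maskedᶜ-sound (e-mu s) = mu≥ (maskedᶜ-search s)

  maskedᶜs-sound {j} {xs = xs} ev-[] =
    ∷≥ (queryFree (subst (λ v → Eval g (proj (Fin.fromℕ j)) (xs ∷ʳ k) v []) (lookup-∷ʳ-fromℕ xs) e-proj)) []≥
  maskedᶜs-sound (ev-∷ a b) = ∷≥ (maskedᶜ-sound a) (maskedᶜs-sound b)

  maskedᶜ-search (s-hit a) = hit≥ (maskedᶜ-sound a)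
  maskedᶜ-search (s-next a b) = next≥ (maskedᶜ-sound a) (maskedᶜ-search b)

search≥ : ∀ {F : Code (suc k)} (t : ℕ → ℕ) {d} →
  (∀ z → z ≤ d → Eval≥ α m F (z ∷ xs) (t z)) → t d ≡ 0 →
  ∃[ z ] z ≤ d × t z ≡ 0 × Eval≥ α m (mu F) xs z
search≥ {α = α} {m} {xs = xs} {F} t {d} trial td≡0 =
  let z , z≤d , tz≡0 , S = searchFrom d 0 (+-identityʳ d) in z , z≤d , tz≡0 , mu≥ S
  where
  y≤d : ∀ r y → r + y ≡ d → y ≤ d
  y≤d r y r+y≡d = subst (y ≤_) r+y≡d (m≤n+m y r)

  searchFrom : ∀ r y → r + y ≡ d → ∃[ z ] z ≤ d × t z ≡ 0 × Search≥ α m F xs y z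
  searchFrom zero y refl = y , ≤-refl , td≡0 , hit≥ (subst (Eval≥ α m F (y ∷ xs)) td≡0 (trial y ≤-refl))
  searchFrom (suc r) y r+y≡d with t y in ty | trial y (y≤d (suc r) y r+y≡d)
  ... | zero  | E = y , y≤d (suc r) y r+y≡d , ty , hit≥ E
  ... | suc _ | E with searchFrom r (suc y) (trans (+-suc r y) r+y≡d)
  ...   | z , z≤d , tz≡0 , S = z , z≤d , tz≡0 , next≥ E S

1∸code≡0⇒just : ∀ {x : Maybe ℕ} → 1 ∸ code x ≡ 0 → ∃[ w ] x ≡ just w
1∸code≡0⇒just {nothing} ()
1∸code≡0⇒just {just w} _ = w , refl

z≤n∸k⇒k≤n∸z : ∀ {z k} → k ≤ n → z ≤ n ∸ k → k ≤ n ∸ z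
z≤n∸k⇒k≤n∸z {n} {z} {k} k≤n z≤n∸k =
  m+n≤o⇒m≤o∸n k (subst (_≤ n) (+-comm z k) (m≤o∸n⇒m+n≤o z k≤n z≤n∸k))

module MaskedReduction (g h : ℕ → ℕ) (Φ : TuringFunctional)
  (Φ-scf : ∀ f → IsSCF f g → ∃[ F ] (Φ computesᴹ F from f × IsSCF F h)) where

  F : ℕ → ℕ → Maybe ℕ
  F k = proj₁ (Φ-scf (maskBelow g k) (maskBelow-isSCF g k))

  F-isSCF : ∀ k → IsSCF (F k) h
  F-isSCF k = proj₂ (proj₂ (Φ-scf (maskBelow g k) (maskBelow-isSCF g k)))

  Defined : ℕ → ℕ → Set
  Defined k n = ∃[ w ] F k n ≡ just w

  Φ̂ : Code 2
  Φ̂ = maskedᶜ Φ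

  Φ̂-eval : ∀ n k → Eval≥ g k Φ̂ (n ∷ k ∷ []) (code (F k n))
  Φ̂-eval n k = maskedᶜ-sound g k (proj₂ (proj₁ (proj₂ (Φ-scf (maskBelow g k) (maskBelow-isSCF g k))) n))

  -- Fᶜ runs Φ under the mask n ∸ z, so the search below tries the masks n, n - 1, …, 0.
  Fᶜ : Code 2
  Fᶜ = comp Φ̂ (proj (suc zero) ∷ comp flip∸ᶜ (proj zero ∷ proj (suc zero) ∷ []) ∷ [])

  Fᶜ-eval : ∀ z n → Eval≥ g (n ∸ z) Fᶜ (z ∷ n ∷ []) (code (F (n ∸ z) n))
  Fᶜ-eval z n = comp≥ (queryFreeVec (ev-∷ e-proj (ev-∷ mask ev-[]))) (Φ̂-eval n (n ∸ z))
    where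
    mask : Eval g (comp flip∸ᶜ (proj zero ∷ proj (suc zero) ∷ [])) (z ∷ n ∷ []) (n ∸ z) []
    mask = e-comp (ev-∷ e-proj (ev-∷ e-proj ev-[])) (flip∸ᶜ-eval z n)

  undefinedᶜ : Code 2
  undefinedᶜ = comp isZeroᶜ (Fᶜ ∷ [])

  undefinedᶜ-eval : ∀ z n → Eval≥ g (n ∸ z) undefinedᶜ (z ∷ n ∷ []) (1 ∸ code (F (n ∸ z) n))
  undefinedᶜ-eval z n = comp≥ (∷≥ (Fᶜ-eval z n) []≥) (queryFree (isZeroᶜ-eval _))

  searchᶜ : Code 1
  searchᶜ = comp predᶜ (comp Fᶜ (mu undefinedᶜ ∷ proj zero ∷ []) ∷ [])

  searchᶜ-eval : ∀ n k → k ≤ n → Defined k n → Eval≥ g k searchᶜ (n ∷ []) (h n)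
  searchᶜ-eval n k k≤n (w , Fkn≡w)
    with search≥ (λ z → 1 ∸ code (F (n ∸ z) n)) trial defined-at-k
    where
    trial : ∀ z → z ≤ n ∸ k → Eval≥ g k undefinedᶜ (z ∷ n ∷ []) (1 ∸ code (F (n ∸ z) n))
    trial z z≤n∸k = weaken≥ (z≤n∸k⇒k≤n∸z k≤n z≤n∸k) (undefinedᶜ-eval z n)

    defined-at-k : 1 ∸ code (F (n ∸ (n ∸ k)) n) ≡ 0
    defined-at-k rewrite m∸[m∸n]≡n k≤n | Fkn≡w = 0∸n≡0 w
  ... | z , z≤n∸k , found , μ↓z with 1∸code≡0⇒just found
  ... | w′ , Fzn≡w′ =
    subst (Eval≥ g k searchᶜ (n ∷ [])) value
      (comp≥ (∷≥ (comp≥ (∷≥ μ↓z (queryFreeVec (ev-∷ e-proj ev-[])))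
                        (weaken≥ (z≤n∸k⇒k≤n∸z k≤n z≤n∸k) (Fᶜ-eval z n))) []≥)
             (queryFree (predᶜ-eval _)))
    where
    value : pred (code (F (n ∸ z) n)) ≡ h n
    value = trans (cong (pred ∘ code) Fzn≡w′) (proj₁ (F-isSCF (n ∸ z)) n w′ Fzn≡w′)

  N₀ : ℕ
  N₀ = proj₁ (proj₂ (F-isSCF 0))

  eventually-defined : ∀ k → ∃[ N ] ∀ n → N ≤ n → Defined k n
  eventually-defined k = proj₂ (F-isSCF k)

  -- Below N₀ even the unmasked description F 0 may be undefined, so h is tabulated there.
  Ψ : Code 1
  Ψ = ifᶜ atLeastᶜ N₀ then searchᶜ else tableᶜ h N₀

  Ψ-eval : ∀ n k → k ≤ n → (N₀ ≤ n → Defined k n) → Eval≥ g k Ψ (n ∷ []) (h n)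
  Ψ-eval n k k≤n defined with N₀ ≤? n
  ... | yes N₀≤n = ifᶜ-then (queryFree (atLeastᶜ-yes N₀≤n))
                            (searchᶜ-eval n k k≤n (defined N₀≤n))
                            (queryFree (proj₂ (tableᶜ-halts h N₀ n)))
  ... | no  N₀≰n = ifᶜ-else (queryFree (atLeastᶜ-no (≰⇒> N₀≰n)))
                            (queryFree (tableᶜ-eval h N₀ n (≰⇒> N₀≰n)))

proposition4p4 : (g h : ℕ → ℕ) → h ≤scf g → h ≤ubfb g
proposition4p4 g h (Φ , Φ-scf) = Ψ , computes , queries-escape
  where
  open MaskedReduction g h Φ Φ-scf

  computes : ∀ n → Ψ ⟨ g ⟩ n ↓ h n
  computes n =
    let qs , E , _ = Ψ-eval n 0 z≤n (proj₂ (eventually-defined 0) n) in qs , E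

  queries-escape : ∀ m → ∃[ N ] ∀ n → N ≤ n → ∀ v qs → Eval g Ψ (n ∷ []) v qs → All (m ≤_) qs
  queries-escape m = Nₘ ⊔ m , λ n Nₘ⊔m≤n _ _ →
    Eval≥-queries (Ψ-eval n m (≤-trans (m≤n⊔m Nₘ m) Nₘ⊔m≤n)
                             (λ _ → defined n (≤-trans (m≤m⊔n Nₘ m) Nₘ⊔m≤n)))
    where
    Nₘ : ℕ
    Nₘ = proj₁ (eventually-defined m)

    defined : ∀ n → Nₘ ≤ n → Defined m n
    defined = proj₂ (eventually-defined m)
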